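{- Let $(a_n)_{n\in\mathbb{N}}$ and $(b_n)_{n\in\mathbb{N}}$ be increasing sequences of positive integers, and let $G$ be the invariant subtraction game on $\mathbb{N}_0\times\mathbb{N}_0$ with $\mathcal{M}(G)=\{\{a_n,b_n\}\mid n\in\mathbb{N}\}$. Then: (i) $\{0,k\}\in\mathcal{P}(G)$ for all $k\in\mathbb{N}_0$; (ii) $\{k,l\}\in\mathcal{P}(G)$ whenever $k,l\in\{1,2,\ldots,b_1-1\}$; (iii) for $k,l>0$, $\{k,l\}\in\mathcal{N}(G)$ if, for some $n\ge 1$, either (a) $k=a_n$ and $l\ge b_n$, or (b) $k=b_n$ and $l\ge a_n$; or if, for some $n\ge 2$, (c) $k=a_n$, $a_n=a_{n-1}+1$ and $b_{n-1}\le l<b_{n-1}+b_1$.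
   Context: $\mathbb{N}$ denotes the positive integers, $\mathbb{N}_0$ the non-negative integers. The board $\mathbb{N}_0^2$ carries componentwise addition, subtraction $\ominus$ and partial order $\preceq$. An invariant subtraction game with move set $\mathcal{M}(G)$ is the game in which the options of a position $\boldsymbol x$ are the positions $\boldsymbol x\ominus\boldsymbol r$ with $\boldsymbol r\in\mathcal{M}(G)$, $\boldsymbol r\preceq\boldsymbol x$; players alternate, and the last player to move wins. A position is a $P$-position if all its options are $N$-positions, an $N$-position otherwise; $\mathcal{P}(G)$, $\mathcal{N}(G)$ denote these sets. The notation $\{r,s\}$ means both ordered pairs $(r,s)$ and $(s,r)$; e.g. $\mathcal{M}(G)=\{(a_n,b_n),(b_n,a_n)\mid n\in\mathbb{N}\}$, and $\{k,l\}\in\mathcal{P}(G)$ means $(k,l),(l,k)\in\mathcal{P}(G)$. -}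

module Defs where

open import Data.Nat using (ℕ; _≤_; _<_; _∸_)
open import Data.Product using (_×_; ∃-syntax)
open import Data.Sum using (_⊎_)
open import Relation.Binary.PropositionalEquality using (_≡_)

-- Sequences (a_n), (b_n) are functions ℕ → ℕ; only indices n ≥ 1 are used
-- (the paper indexes by n ∈ ℕ = {1,2,...}); the value at index 0 is irrelevant.

Increasing : (ℕ → ℕ) → Set
Increasing a = ∀ n → 1 ≤ n → a n < a (Data.Nat.suc n)

Positive : (ℕ → ℕ) → Set
Positive a = ∀ n → 1 ≤ n → 1 ≤ a n

Move : (a b : ℕ → ℕ) → ℕ → ℕ → Set
Move a b r s = ∃[ n ] (1 ≤ n × ((r ≡ a n × s ≡ b n) ⊎ (r ≡ b n × s ≡ a n)))

-- P: all options are N; N: some option is P.  (Inductive = well-founded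
-- reading; all moves are nonzero here, so every play terminates.)
mutual
  data IsP (a b : ℕ → ℕ) (x y : ℕ) : Set where
    allN : (∀ r s → Move a b r s → r ≤ x → s ≤ y → IsN a b (x ∸ r) (y ∸ s))
         → IsP a b x y

  data IsN (a b : ℕ → ℕ) (x y : ℕ) : Set where
    someP : ∀ r s → Move a b r s → r ≤ x → s ≤ y → IsP a b (x ∸ r) (y ∸ s)
          → IsN a b x y

PairP : (a b : ℕ → ℕ) → ℕ → ℕ → Set
PairP a b k l = IsP a b k l × IsP a b l k

PairN : (a b : ℕ → ℕ) → ℕ → ℕ → Set
PairN a b k l = IsN a b k l × IsN a b l k

module Submission where

-- The move set {(a_n,b_n),(b_n,a_n)} is symmetric, so the game is
-- invariant under swapping the two coordinates (swapP / swapN); hence every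
-- claim about a pair {k,l} reduces to a claim about the single position (k,l).
-- Every move has both coordinates ≥ 1 (positivity) and one coordinate equal to
-- some b_n ≥ b_1 (monotonicity of b).  Consequently a position with a zero
-- coordinate, or with both coordinates below b_1, has no options at all and is
-- a P-position: this gives (i) and (ii).  For (iii) we exhibit a winning move:
-- from (a_n, b_n + d) or (b_n, a_n + d) the move to (0, d) reaches a P-position
-- by (i); in case (c), from (a_{n-1} + 1, b_{n-1} + d) with d < b_1 the move
-- (a_{n-1}, b_{n-1}) reaches (1, d), a P-position by (i) or (ii).

open import Defs
open import Data.Nat using (ℕ; suc; zero; _+_; _≤_; _<_; _∸_; z≤n; s≤s; NonZero; >-nonZero)
open import Data.Nat.Properties
  using (≤-refl; ≤-trans; <-≤-trans; ≤-<-trans; <⇒≤; <-irrefl; m≤m+n; m+n∸m≡n;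
         m+[n∸m]≡n; +-identityʳ; m≤pred[n]⇒suc[m]≤n; m<n+o⇒m∸n<o)
open import Data.Product using (_×_; ∃-syntax; _,_; proj₁)
open import Data.Sum using (_⊎_; inj₁; inj₂)
open import Data.Empty using (⊥; ⊥-elim)
open import Relation.Binary.PropositionalEquality using (_≡_; refl; sym; subst₂)

increasing⇒first≤ : ∀ (f : ℕ → ℕ) → Increasing f → ∀ n → 1 ≤ n → f 1 ≤ f n
increasing⇒first≤ f inc (suc zero)    _ = ≤-refl
increasing⇒first≤ f inc (suc (suc n)) _ =
  ≤-trans (increasing⇒first≤ f inc (suc n) (s≤s z≤n)) (<⇒≤ (inc (suc n) (s≤s z≤n)))

module Game (a b : ℕ → ℕ) where

  move-swap : ∀ {r s} → Move a b r s → Move a b s r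
  move-swap (n , n≥1 , inj₁ (r≡a , s≡b)) = n , n≥1 , inj₂ (s≡b , r≡a)
  move-swap (n , n≥1 , inj₂ (r≡b , s≡a)) = n , n≥1 , inj₁ (s≡a , r≡b)

  mutual
    swapP : ∀ {x y} → IsP a b x y → IsP a b y x
    swapP (allN options) =
      allN λ r s m r≤y s≤x → swapN (options s r (move-swap m) s≤x r≤y)

    swapN : ∀ {x y} → IsN a b x y → IsN a b y x
    swapN (someP r s m r≤x s≤y p) = someP s r (move-swap m) s≤y r≤x (swapP p)

  terminalP : ∀ x y → (∀ r s → Move a b r s → r ≤ x → s ≤ y → ⊥) → IsP a b x y
  terminalP x y noMove = allN λ r s m r≤x s≤y → ⊥-elim (noMove r s m r≤x s≤y)

  moveToP : ∀ {r s u v} → Move a b r s → IsP a b u v → IsN a b (r + u) (s + v)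
  moveToP {r} {s} {u} {v} m p =
    someP r s m (m≤m+n r u) (m≤m+n s v)
      (subst₂ (IsP a b) (sym (m+n∸m≡n r u)) (sym (m+n∸m≡n s v)) p)

module Lemma (a b : ℕ → ℕ) (inc-b : Increasing b) (pos-a : Positive a) (pos-b : Positive b) where

  open Game a b

  instance
    b₁-nonZero : NonZero (b 1)
    b₁-nonZero = >-nonZero (pos-b 1 (s≤s z≤n))

  below-b₁ : ∀ {k} → k ≤ b 1 ∸ 1 → k < b 1
  below-b₁ = m≤pred[n]⇒suc[m]≤n

  move-positive : ∀ {r s} → Move a b r s → 1 ≤ r × 1 ≤ s
  move-positive (n , n≥1 , inj₁ (refl , refl)) = pos-a n n≥1 , pos-b n n≥1
  move-positive (n , n≥1 , inj₂ (refl , refl)) = pos-b n n≥1 , pos-a n n≥1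

  move-large : ∀ {r s} → Move a b r s → b 1 ≤ r ⊎ b 1 ≤ s
  move-large (n , n≥1 , inj₁ (_ , refl)) = inj₂ (increasing⇒first≤ b inc-b n n≥1)
  move-large (n , n≥1 , inj₂ (refl , _)) = inj₁ (increasing⇒first≤ b inc-b n n≥1)

  zeroP : ∀ k → IsP a b 0 k
  zeroP k = terminalP 0 k λ r s m r≤0 _ → <-irrefl refl (≤-trans (proj₁ (move-positive m)) r≤0)

  smallP : ∀ x y → x < b 1 → y < b 1 → IsP a b x y
  smallP x y x<b₁ y<b₁ = terminalP x y λ r s m r≤x s≤y → case-large (move-large m) r≤x s≤y
    where
    case-large : ∀ {r s} → b 1 ≤ r ⊎ b 1 ≤ s → r ≤ x → s ≤ y → ⊥
    case-large (inj₁ b₁≤r) r≤x _ = <-irrefl refl (<-≤-trans (≤-<-trans r≤x x<b₁) b₁≤r)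
    case-large (inj₂ b₁≤s) _ s≤y = <-irrefl refl (<-≤-trans (≤-<-trans s≤y y<b₁) b₁≤s)

  oneP : ∀ d → d < b 1 → IsP a b 1 d
  oneP zero    _    = swapP (zeroP 1)
  oneP (suc d) d<b₁ = smallP 1 (suc d) (≤-<-trans (s≤s z≤n) d<b₁) d<b₁

  moveToZeroN : ∀ {r s l} → Move a b r s → s ≤ l → IsN a b r l
  moveToZeroN {r} {s} {l} m s≤l =
    subst₂ (IsN a b) (+-identityʳ r) (m+[n∸m]≡n s≤l) (moveToP m (zeroP (l ∸ s)))

  successorN : ∀ m l → 1 ≤ m → a (suc m) ≡ a m + 1 → b m ≤ l → l < b m + b 1
             → IsN a b (a (suc m)) l
  successorN m l m≥1 a-step b≤l l<b+b₁ =
    subst₂ (IsN a b) (sym a-step) (m+[n∸m]≡n b≤l) (moveToP (m , m≥1 , inj₁ (refl , refl)) (oneP d d<b₁))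
    where
    d : ℕ
    d = l ∸ b m
    d<b₁ : d < b 1
    d<b₁ = m<n+o⇒m∸n<o l (b m) l<b+b₁

lemma2p3 : (a b : ℕ → ℕ) → Increasing a → Increasing b → Positive a → Positive b →
    ((k : ℕ) → PairP a b 0 k)
    × ((k l : ℕ) → 1 ≤ k → k ≤ b 1 ∸ 1 → 1 ≤ l → l ≤ b 1 ∸ 1 → PairP a b k l)
    × ((k l : ℕ) → 1 ≤ k → 1 ≤ l →
        ((∃[ n ] (1 ≤ n × ((k ≡ a n × b n ≤ l) ⊎ (k ≡ b n × a n ≤ l))))
         ⊎ (∃[ n ] (2 ≤ n × k ≡ a n × a n ≡ a (n ∸ 1) + 1
                   × b (n ∸ 1) ≤ l × l < b (n ∸ 1) + b 1)))
        → PairN a b k l)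
lemma2p3 a b _ inc-b pos-a pos-b =
    (λ k → zeroP k , swapP (zeroP k))
  , (λ k l _ k≤ _ l≤ → let p = smallP k l (below-b₁ k≤) (below-b₁ l≤) in p , swapP p)
  , λ k l _ _ h → let p = winning k l h in p , swapN p
  where
  open Game a b
  open Lemma a b inc-b pos-a pos-b

  winning : ∀ k l → (∃[ n ] (1 ≤ n × ((k ≡ a n × b n ≤ l) ⊎ (k ≡ b n × a n ≤ l))))
                    ⊎ (∃[ n ] (2 ≤ n × k ≡ a n × a n ≡ a (n ∸ 1) + 1
                              × b (n ∸ 1) ≤ l × l < b (n ∸ 1) + b 1))
          → IsN a b k l
  winning _ l (inj₁ (n , n≥1 , inj₁ (refl , b≤l))) = moveToZeroN (n , n≥1 , inj₁ (refl , refl)) b≤l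
  winning _ l (inj₁ (n , n≥1 , inj₂ (refl , a≤l))) = moveToZeroN (n , n≥1 , inj₂ (refl , refl)) a≤l
  winning _ l (inj₂ (suc m , s≤s m≥1 , refl , a-step , b≤l , l<)) = successorN m l m≥1 a-step b≤l l<
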